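{- Let $b>1$ be an odd integer. The only infinite smooth word $w$ over $\{1,b\}$ that is an infinite Lyndon word and such that $\Phi(w)$ starts with $11$ is $\Delta^{ -1}_1(m_{\{1<b\}})$.
   Context: Words are compared lexicographically with $1<b$. For a word $w$ over $\{1,b\}$ written as maximal blocks $\alpha_0^{i_0}\alpha_1^{i_1}\cdots$ ($\alpha_{k+1}\ne\alpha_k$, $i_k\ge1$), $\Delta(w)=i_0i_1\cdots$. An infinite word $w\in\{1,b\}^\omega$ is smooth if $\Delta^k(w)\in\{1,b\}^\omega$ for all $k\ge0$. $\Phi(w)=\Delta^0(w)[0]\,\Delta^1(w)[0]\,\Delta^2(w)[0]\cdots$. $m_{\{1<b\}}$ is the lexicographically minimal infinite smooth word over $\{1,b\}$. For a word $u$ over positive integers, $\Delta^{ -1}_1(u)=1^{u[0]}b^{u[1]}1^{u[2]}b^{u[3]}\cdots$. An infinite Lyndon word is an infinite word strictly smaller than each of its proper suffixes. -}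

module Defs where

open import Data.Nat using (ℕ; zero; suc; _+_; _∸_; _≤_; _<_; _<?_; _%_)
open import Data.Product using (Σ; _×_; ∃)
open import Data.Sum using (_⊎_)
open import Relation.Nullary using (¬_; yes; no)
open import Relation.Binary.PropositionalEquality using (_≡_; _≢_)

Word : Set
Word = ℕ → ℕ

_≈w_ : Word → Word → Set
w ≈w v = ∀ n → w n ≡ v n

OverAlph : ℕ → Word → Set
OverAlph b w = ∀ n → w n ≡ 1 ⊎ w n ≡ b

_<lex_ : Word → Word → Set
w <lex v = Σ ℕ λ i → (∀ j → j < i → w j ≡ v j) × w i < v i

_≤lex_ : Word → Word → Set
w ≤lex v = w <lex v ⊎ w ≈w v

suffix : ℕ → Word → Word
suffix k w n = w (k + n)

InfLyndon : Word → Set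
InfLyndon w = ∀ k → 1 ≤ k → w <lex suffix k w

-- IsΔ w u : the infinite word w decomposes into infinitely many maximal
-- (finite, nonempty) blocks, the i-th block having length u i and starting
-- at position s i; i.e. Δ(w) = u as an infinite word.
IsΔ : Word → Word → Set
IsΔ w u = Σ (ℕ → ℕ) λ s →
    s 0 ≡ 0
  × (∀ i → s (suc i) ≡ s i + u i)
  × (∀ i → 1 ≤ u i)
  × (∀ i j → s i ≤ j → j < s (suc i) → w j ≡ w (s i))
  × (∀ i → w (s (suc i)) ≢ w (s i))

-- W is the tower of iterated run-length encodings of w, all lying in {1,b}^ω:
-- W k = Δ^k(w).
DeltaTower : ℕ → Word → (ℕ → Word) → Set
DeltaTower b w W = W 0 ≈w w × (∀ k → OverAlph b (W k)) × (∀ k → IsΔ (W k) (W (suc k)))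

Smooth : ℕ → Word → Set
Smooth b w = ∃ λ W → DeltaTower b w W

-- Φ(w) starts with 11: Φ(w)[k] = Δ^k(w)[0].
PhiStarts11 : ℕ → Word → Set
PhiStarts11 b w = ∃ λ W → DeltaTower b w W × W 0 0 ≡ 1 × W 1 0 ≡ 1

IsMinSmooth : ℕ → Word → Set
IsMinSmooth b m = Smooth b m × (∀ w → Smooth b w → m ≤lex w)

-- Δ^{-1}_a,c (u) = a^{u0} c^{u1} a^{u2} ...  (computed with fuel; fuel suc n
-- suffices for position n whenever all u i ≥ 1).
decodeF : ℕ → ℕ → ℕ → Word → ℕ → ℕ
decodeF zero      a c u n = a
decodeF (suc f) a c u n with n <? u 0
... | yes _ = a
... | no  _ = decodeF f c a (λ i → u (suc i)) (n ∸ u 0)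

Δinv₁ : ℕ → Word → Word
Δinv₁ b u n = decodeF (suc n) 1 b u n

-- Write Δ⁻¹ a for the inverse of Δ starting with the letter a.  Because b is odd, every run of a
-- word over {1,b} has odd length, so its i-th run starts at a position of the same parity as i.
-- Hence, for two such words with the same first letter, the lexicographic order can be read off
-- their run-length sequences: at the first index j where these differ, the word whose j-th run is
-- shorter is the smaller one exactly when that run consists of b's.
--
-- Two consequences give the theorem.  First, Δ⁻¹ 1 ∘ Δ⁻¹ b is strictly monotone, so minimality
-- forces m = 1…, Δm = b… and Δ²m = m.  Second, if w is Lyndon and Φ(w) starts with 11, the words
-- Δᵏ(w), k ≥ 1, alternate between two shapes: EvenMin (1 at even positions, strictly below its
-- suffixes at even positions) and EvenMax (first letter b, 1 at odd positions, strictly above its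
-- suffixes at even positions).  So their first letters are those of m, Δm, m, …, and as a tower
-- of smooth words is determined by its first letters, Δ(w) = m.  Conversely, m and Δm have these
-- two shapes, and Δ⁻¹ 1 of an EvenMin word is Lyndon.

module Submission where

open import Defs
open import Data.Nat using (ℕ; zero; suc; _+_; _∸_; _≤_; _<_; _<?_; _%_; z≤n; s≤s; _≟_; parity)
open import Data.Nat.Properties
open import Data.Nat.Induction using (<-rec)
open import Data.Parity.Base as ℙ using (Parity; 0ℙ; 1ℙ; _⁻¹)
open import Data.Parity.Properties using (suc-homo-⁻¹; ⁻¹-selfInverse; +-homo-+) renaming (_≟_ to _≟ℙ_)
open import Data.Product using (_×_; ∃; _,_; proj₁; proj₂)
open import Data.Sum using (_⊎_; inj₁; inj₂; [_,_]′)
open import Relation.Nullary using (¬_; yes; no; contradiction)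
open import Relation.Binary.PropositionalEquality
open import Relation.Binary.Definitions using (tri<; tri≈; tri>)
open import Function.Base using (_∘_)
open import Function.Bundles using (_⇔_; mk⇔)

≈w-sym : ∀ {w v} → w ≈w v → v ≈w w
≈w-sym e n = sym (e n)

≈w-trans : ∀ {w v z} → w ≈w v → v ≈w z → w ≈w z
≈w-trans e f n = trans (e n) (f n)

<lex-asym : ∀ {w v} → w <lex v → ¬ v <lex w
<lex-asym (i , agree , lt) (j , agree′ , lt′) with <-cmp i j
... | tri< i<j _ _ = <-irrefl (sym (agree′ i i<j)) lt
... | tri≈ _ refl _ = <-asym lt lt′
... | tri> _ _ j<i = <-irrefl (sym (agree j j<i)) lt′

<lex-irrefl : ∀ {w v} → w ≈w v → ¬ w <lex v
<lex-irrefl e (i , _ , lt) = <-irrefl (e i) lt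

<lex-resp-≈ : ∀ {w w′ v v′} → w ≈w w′ → v ≈w v′ → w <lex v → w′ <lex v′
<lex-resp-≈ e f (i , agree , lt) =
  i , (λ j j<i → trans (sym (e j)) (trans (agree j j<i) (f j))) , subst₂ _<_ (e i) (f i) lt

≤lex⇒≯lex : ∀ {w v} → w ≤lex v → ¬ v <lex w
≤lex⇒≯lex (inj₁ w<v) = <lex-asym w<v
≤lex⇒≯lex (inj₂ w≈v) = <lex-irrefl (≈w-sym w≈v)

InfLyndon-resp-≈ : ∀ {w v} → w ≈w v → InfLyndon w → InfLyndon v
InfLyndon-resp-≈ e lyndon k 1≤k = <lex-resp-≈ e (λ n → e (k + n)) (lyndon k 1≤k)

≮lex∧≯lex⇒≈w : ∀ {w v} → ¬ w <lex v → ¬ v <lex w → w ≈w v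
≮lex∧≯lex⇒≈w {w} {v} w≮v v≮w = <-rec (λ n → w n ≡ v n) step
  where
  step : ∀ n → (∀ {k} → k < n → w k ≡ v k) → w n ≡ v n
  step n below with <-cmp (w n) (v n)
  ... | tri< lt _ _ = contradiction (n , (λ k k<n → below k<n) , lt) w≮v
  ... | tri≈ _ eq _ = eq
  ... | tri> _ _ gt = contradiction (n , (λ k k<n → sym (below k<n)) , gt) v≮w

first-difference : (u v : Word) → ∀ p →
  (∀ k → k < p → u k ≡ v k) ⊎ ∃ λ j → (∀ k → k < j → u k ≡ v k) × u j ≢ v j
first-difference u v zero = inj₁ (λ k ())
first-difference u v (suc p) with first-difference u v p
... | inj₂ found = inj₂ found
... | inj₁ below with u p ≟ v p
...   | no ne = inj₂ (p , below , ne)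
...   | yes eq = inj₁ λ k k<1+p → [ below k , (λ { refl → eq }) ]′ (m≤n⇒m<n∨m≡n (≤-pred k<1+p))

parity-suc : ∀ n → parity (suc n) ≡ parity n ⁻¹
parity-suc n = sym (⁻¹-selfInverse (suc-homo-⁻¹ n))

parity-+-even : ∀ k j → parity k ≡ 0ℙ → parity (k + j) ≡ parity j
parity-+-even k j k-even = trans (+-homo-+ k j) (cong (ℙ._+ parity j) k-even)

+1ℙ≡⁻¹ : ∀ p → p ℙ.+ 1ℙ ≡ p ⁻¹
+1ℙ≡⁻¹ 0ℙ = refl
+1ℙ≡⁻¹ 1ℙ = refl

parity-+1 : ∀ n → parity (n + 1) ≡ parity n ⁻¹
parity-+1 n = trans (+-homo-+ n 1) (+1ℙ≡⁻¹ (parity n))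

≢⇒≡⁻¹ : ∀ {p q} → p ≢ q → p ≡ q ⁻¹
≢⇒≡⁻¹ {0ℙ} {0ℙ} ne = contradiction refl ne
≢⇒≡⁻¹ {0ℙ} {1ℙ} _ = refl
≢⇒≡⁻¹ {1ℙ} {0ℙ} _ = refl
≢⇒≡⁻¹ {1ℙ} {1ℙ} ne = contradiction refl ne

%2≡1⇒parity≡1ℙ : ∀ n → n % 2 ≡ 1 → parity n ≡ 1ℙ
%2≡1⇒parity≡1ℙ 1 _ = refl
%2≡1⇒parity≡1ℙ (suc (suc n)) odd = %2≡1⇒parity≡1ℙ n odd

alternating : ∀ {ℓ} {A : Set ℓ} → A → A → ℕ → A
alternating a c zero = a
alternating a c (suc k) = alternating c a k

alternating-preserves : ∀ {ℓ ℓ′} {A : Set ℓ} (P : A → Set ℓ′) {a c : A} →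
  P a → P c → ∀ k → P (alternating a c k)
alternating-preserves P pa pc zero = pa
alternating-preserves P pa pc (suc k) = alternating-preserves P pc pa k

alternating-relate : ∀ {ℓ ℓ′ ℓ″ ℓ‴} {A : Set ℓ} {B : Set ℓ′} {P Q : A → Set ℓ″}
  (R : A → B → Set ℓ‴) {a c : B} → (∀ {x} → P x → R x a) → (∀ {x} → Q x → R x c) →
  ∀ k {x} → alternating P Q k x → R x (alternating a c k)
alternating-relate R fa fc zero = fa
alternating-relate R fa fc (suc k) = alternating-relate R fc fa k

alternating-induction : ∀ {ℓ ℓ′} {A : Set ℓ} {P Q : A → Set ℓ′} (V : ℕ → A) →
  (∀ k → P (V k) → Q (V (suc k))) → (∀ k → Q (V k) → P (V (suc k))) → P (V 0) →
  ∀ k → alternating P Q k (V k)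
alternating-induction V pq qp p0 zero = p0
alternating-induction V pq qp p0 (suc k) = alternating-induction (V ∘ suc) (qp ∘ suc) (pq ∘ suc) (pq 0 p0) k

Positive : Word → Set
Positive u = ∀ i → 1 ≤ u i

record Runs (x u : Word) : Set where
  field
    start : ℕ → ℕ
    start-zero : start 0 ≡ 0
    start-suc : ∀ i → start (suc i) ≡ start i + u i
    length-pos : Positive u
    constant : ∀ i j → start i ≤ j → j < start (suc i) → x j ≡ x (start i)
    changes : ∀ i → x (start (suc i)) ≢ x (start i)

open Runs public

IsΔ⇒Runs : ∀ {x u} → IsΔ x u → Runs x u
IsΔ⇒Runs (s , s0 , sS , pos , const , chg) = record
  { start = s ; start-zero = s0 ; start-suc = sS ; length-pos = pos ; constant = const ; changes = chg }

Runs⇒IsΔ : ∀ {x u} → Runs x u → IsΔ x u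
Runs⇒IsΔ r = start r , start-zero r , start-suc r , length-pos r , constant r , changes r

Runs-resp-lengths : ∀ {x u u′} → u ≈w u′ → Runs x u → Runs x u′
Runs-resp-lengths e r = record
  { start = start r ; start-zero = start-zero r
  ; start-suc = λ i → trans (start-suc r i) (cong (start r i +_) (e i))
  ; length-pos = λ i → subst (1 ≤_) (e i) (length-pos r i)
  ; constant = constant r ; changes = changes r }

Runs-resp-word : ∀ {x x′ u} → x ≈w x′ → Runs x u → Runs x′ u
Runs-resp-word e r = record
  { start = start r ; start-zero = start-zero r ; start-suc = start-suc r ; length-pos = length-pos r
  ; constant = λ i j lo hi → trans (sym (e j)) (trans (constant r i j lo hi) (e _))
  ; changes = λ i eq → changes r i (trans (e _) (trans eq (sym (e _)))) }

module _ {x u : Word} (r : Runs x u) where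

  start<start-suc : ∀ i → start r i < start r (suc i)
  start<start-suc i = subst (start r i <_) (sym (start-suc r i)) (m<m+n (start r i) (length-pos r i))

  start-mono-≤ : ∀ {i j} → i ≤ j → start r i ≤ start r j
  start-mono-≤ {i} {j} i≤j with m≤n⇒∃[o]m+o≡n i≤j
  ... | k , refl = go i k
    where
    go : ∀ i k → start r i ≤ start r (i + k)
    go i zero = ≤-reflexive (cong (start r) (sym (+-identityʳ i)))
    go i (suc k) = ≤-trans (go i k)
      (≤-trans (<⇒≤ (start<start-suc (i + k))) (≤-reflexive (cong (start r) (sym (+-suc i k)))))

  ≤start : ∀ i → i ≤ start r i
  ≤start zero = z≤n
  ≤start (suc i) = ≤-trans (s≤s (≤start i)) (start<start-suc i)

  run-of : ∀ p → ∃ λ i → start r i ≤ p × p < start r (suc i)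
  run-of zero = 0 , ≤-reflexive (start-zero r) , subst (_< start r 1) (start-zero r) (start<start-suc 0)
  run-of (suc p) with run-of p
  ... | i , lo , hi with suc p <? start r (suc i)
  ...   | yes p+1<end = i , ≤-trans lo (n≤1+n p) , p+1<end
  ...   | no p+1≮end = suc i , ≤-reflexive next , subst (_< start r (suc (suc i))) next (start<start-suc (suc i))
    where
    next : start r (suc i) ≡ suc p
    next = ≤-antisym (≮⇒≥ p+1≮end) hi

  run-index-≤ : ∀ {i p} → start r i ≤ p → i ≤ p
  run-index-≤ {i} lo = ≤-trans (≤start i) lo

  unit-run : ∀ {i p} → start r i ≤ p → p < start r (suc i) → u i ≡ 1 → p ≡ start r i
  unit-run {i} {p} lo hi unit = ≤-antisym (≤-pred (subst (p <_) end hi)) lo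
    where
    end : start r (suc i) ≡ suc (start r i)
    end = trans (start-suc r i) (trans (cong (start r i +_) unit) (+-comm _ 1))

  start-one : u 0 ≡ 1 → start r 1 ≡ 1
  start-one unit = trans (start-suc r 0) (cong₂ _+_ (start-zero r) unit)

  start-pos⇒index-pos : ∀ {i} → 1 ≤ start r i → 1 ≤ i
  start-pos⇒index-pos {zero} pos = contradiction (start-zero r) (λ eq → <-irrefl (sym eq) pos)
  start-pos⇒index-pos {suc i} _ = s≤s z≤n

  index<start : 2 ≤ u 0 → ∀ i → 1 ≤ i → i < start r i
  index<start long (suc zero) _ = subst (1 <_) (sym (trans (start-suc r 0) (cong (_+ u 0) (start-zero r)))) long
  index<start long (suc (suc i)) _ = subst (suc (suc i) <_) (sym (start-suc r (suc i)))
    (subst (_≤ start r (suc i) + u (suc i)) (+-comm (suc (suc i)) 1)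
      (+-mono-≤ (index<start long (suc i) (s≤s z≤n)) (length-pos r (suc i))))

  start-parity : (∀ i → parity (u i) ≡ 1ℙ) → ∀ i → parity (start r i) ≡ parity i
  start-parity odd zero = cong parity (start-zero r)
  start-parity odd (suc i) = begin
    parity (start r (suc i))              ≡⟨ cong parity (start-suc r i) ⟩
    parity (start r i + u i)              ≡⟨ +-homo-+ (start r i) (u i) ⟩
    parity (start r i) ℙ.+ parity (u i)   ≡⟨ cong₂ ℙ._+_ (start-parity odd i) (odd i) ⟩
    parity i ℙ.+ 1ℙ                       ≡⟨ +1ℙ≡⁻¹ (parity i) ⟩
    parity i ⁻¹                           ≡⟨ parity-suc i ⟨
    parity (suc i)                        ∎
    where open ≡-Reasoning

  Runs-suffix : ∀ i → Runs (suffix (start r i) x) (suffix i u)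
  Runs-suffix i = record
    { start = shifted ; start-zero = zero′ ; start-suc = suc′ ; length-pos = λ j → length-pos r (i + j)
    ; constant = const′ ; changes = changes′ }
    where
    shifted : ℕ → ℕ
    shifted j = start r (i + j) ∸ start r i
    back : ∀ j → start r i + shifted j ≡ start r (i + j)
    back j = m+[n∸m]≡n (start-mono-≤ (m≤m+n i j))
    back-suc : ∀ j → start r i + shifted (suc j) ≡ start r (suc (i + j))
    back-suc j = trans (back (suc j)) (cong (start r) (+-suc i j))
    zero′ : shifted 0 ≡ 0
    zero′ = trans (cong (λ t → start r t ∸ start r i) (+-identityʳ i)) (n∸n≡0 (start r i))
    suc′ : ∀ j → shifted (suc j) ≡ shifted j + u (i + j)
    suc′ j = trans (cong (λ t → start r t ∸ start r i) (+-suc i j))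
      (trans (cong (_∸ start r i) (start-suc r (i + j))) (+-∸-comm (u (i + j)) (start-mono-≤ (m≤m+n i j))))
    const′ : ∀ k n → shifted k ≤ n → n < shifted (suc k) → x (start r i + n) ≡ x (start r i + shifted k)
    const′ k n lo hi = trans
      (constant r (i + k) (start r i + n) (subst (_≤ start r i + n) (back k) (+-monoʳ-≤ (start r i) lo))
        (subst (start r i + n <_) (back-suc k) (+-monoʳ-< (start r i) hi)))
      (cong x (sym (back k)))
    changes′ : ∀ k → x (start r i + shifted (suc k)) ≢ x (start r i + shifted k)
    changes′ k eq = changes r (i + k) (trans (cong x (sym (back-suc k))) (trans eq (cong x (back k))))

pick : ∀ {ℓ} {A : Set ℓ} → A → A → Parity → A
pick a c 0ℙ = a
pick a c 1ℙ = c

pick-suc : ∀ {ℓ} {A : Set ℓ} (a c : A) i → pick a c (parity (suc i)) ≡ pick c a (parity i)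
pick-suc a c i rewrite parity-suc i with parity i
... | 0ℙ = refl
... | 1ℙ = refl

decode : ℕ → ℕ → Word → Word
decode a c u n = decodeF (suc n) a c u n

partialSum : Word → ℕ → ℕ
partialSum u zero = 0
partialSum u (suc i) = partialSum u i + u i

partialSum-suc : ∀ u i → partialSum u (suc i) ≡ u 0 + partialSum (suffix 1 u) i
partialSum-suc u zero = +-comm 0 (u 0)
partialSum-suc u (suc i) = trans (cong (_+ u (suc i)) (partialSum-suc u i)) (+-assoc (u 0) _ _)

∸-first-run< : ∀ {u n} → Positive u → u 0 ≤ n → n ∸ u 0 < n
∸-first-run< {u} {n} pos u0≤n = ∸-monoʳ-< {n} {u 0} {0} (pos 0) u0≤n

decodeF-fuel : ∀ {f f′ u} → Positive u → ∀ a c n → n < f → n < f′ →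
               decodeF f a c u n ≡ decodeF f′ a c u n
decodeF-fuel {suc f} {suc f′} {u} pos a c n (s≤s n≤f) (s≤s n≤f′) with n <? u 0
... | yes _ = refl
... | no n≮u0 = decodeF-fuel (λ i → pos (suc i)) c a (n ∸ u 0) (<-≤-trans rest< n≤f) (<-≤-trans rest< n≤f′)
  where
  rest< : n ∸ u 0 < n
  rest< = ∸-first-run< pos (≮⇒≥ n≮u0)

decode-in-run : ∀ {u} → Positive u → ∀ a c i n → partialSum u i ≤ n → n < partialSum u (suc i) →
                decode a c u n ≡ pick a c (parity i)
decode-in-run {u} pos a c zero n _ hi with n <? u 0
... | yes _ = refl
... | no n≮u0 = contradiction hi n≮u0
decode-in-run {u} pos a c (suc i) n lo hi with n <? u 0
... | yes n<u0 = contradiction (≤-trans (≤-trans (m≤m+n (u 0) _) (≤-reflexive (sym (partialSum-suc u i)))) lo)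
                               (<⇒≱ n<u0)
... | no n≮u0 = begin
  decodeF n c a (suffix 1 u) (n ∸ u 0)
    ≡⟨ decodeF-fuel pos-tail c a (n ∸ u 0) (∸-first-run< pos u0≤n) (n<1+n _) ⟩
  decode c a (suffix 1 u) (n ∸ u 0)
    ≡⟨ decode-in-run pos-tail c a i (n ∸ u 0) lo′ hi′ ⟩
  pick c a (parity i)
    ≡⟨ pick-suc a c i ⟨
  pick a c (parity (suc i))
    ∎
  where
  open ≡-Reasoning
  pos-tail : Positive (suffix 1 u)
  pos-tail i = pos (suc i)
  u0≤n : u 0 ≤ n
  u0≤n = ≮⇒≥ n≮u0
  split : u 0 + (n ∸ u 0) ≡ n
  split = m+[n∸m]≡n u0≤n
  lo′ : partialSum (suffix 1 u) i ≤ n ∸ u 0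
  lo′ = +-cancelˡ-≤ (u 0) _ _ (subst₂ _≤_ (partialSum-suc u i) (sym split) lo)
  hi′ : n ∸ u 0 < partialSum (suffix 1 u) (suc i)
  hi′ = +-cancelˡ-< (u 0) _ _ (subst₂ _<_ (sym split) (partialSum-suc u (suc i)) hi)

decode-zero : ∀ {u} → Positive u → ∀ a c → decode a c u 0 ≡ a
decode-zero pos a c = decode-in-run pos a c 0 0 z≤n (pos 0)

Runs-decode : ∀ {u a c} → Positive u → a ≢ c → Runs (decode a c u) u
Runs-decode {u} {a} {c} pos a≢c = record
  { start = partialSum u ; start-zero = refl ; start-suc = λ _ → refl ; length-pos = pos
  ; constant = λ i j lo hi → trans (decode-in-run pos a c i j lo hi) (sym (at-start i))
  ; changes = λ i eq → pick-changes (parity i) (trans (sym (pick-suc a c i))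
                                      (trans (sym (at-start (suc i))) (trans eq (at-start i)))) }
  where
  at-start : ∀ i → decode a c u (partialSum u i) ≡ pick a c (parity i)
  at-start i = decode-in-run pos a c i _ ≤-refl (m<m+n (partialSum u i) (pos i))
  pick-changes : ∀ p → pick c a p ≢ pick a c p
  pick-changes 0ℙ eq = a≢c (sym eq)
  pick-changes 1ℙ eq = a≢c eq

decodeF-∈ : ∀ f a c u n → decodeF f a c u n ≡ a ⊎ decodeF f a c u n ≡ c
decodeF-∈ zero a c u n = inj₁ refl
decodeF-∈ (suc f) a c u n with n <? u 0
... | yes _ = inj₁ refl
... | no _ with decodeF-∈ f c a (suffix 1 u) (n ∸ u 0)
...   | inj₁ eq = inj₂ eq
...   | inj₂ eq = inj₁ eq

decodeF-cong : ∀ f a c {u u′} → u ≈w u′ → ∀ n → decodeF f a c u n ≡ decodeF f a c u′ n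
decodeF-cong zero a c e n = refl
decodeF-cong (suc f) a c {u} {u′} e n with n <? u 0 | n <? u′ 0
... | yes _ | yes _ = refl
... | no _ | no _ = trans (decodeF-cong f c a (λ i → e (suc i)) (n ∸ u 0))
                          (cong (λ t → decodeF f c a (suffix 1 u′) (n ∸ t)) (e 0))
... | yes lt | no nlt = contradiction (subst (n <_) (e 0) lt) nlt
... | no nlt | yes lt = contradiction (subst (n <_) (sym (e 0)) lt) nlt

decode-cong : ∀ a c {u u′} → u ≈w u′ → decode a c u ≈w decode a c u′
decode-cong a c e n = decodeF-cong (suc n) a c e n

IsLetter : ℕ → ℕ → Set
IsLetter b c = c ≡ 1 ⊎ c ≡ b

module Alphabet {b : ℕ} (1<b : 1 < b) where

  b≢1 : b ≢ 1
  b≢1 eq = <-irrefl (sym eq) 1<b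

  other : ℕ → ℕ
  other c with c ≟ 1
  ... | yes _ = b
  ... | no _ = 1

  other-letter : ∀ c → IsLetter b (other c)
  other-letter c with c ≟ 1
  ... | yes _ = inj₂ refl
  ... | no _ = inj₁ refl

  other-≢ : ∀ c → other c ≢ c
  other-≢ c with c ≟ 1
  ... | yes refl = b≢1
  ... | no c≢1 = λ eq → c≢1 (sym eq)

  ≢⇒other : ∀ {c d} → IsLetter b c → IsLetter b d → d ≢ c → d ≡ other c
  ≢⇒other {c} c∈ d∈ d≢c with c ≟ 1
  ≢⇒other _ (inj₁ refl) d≢c | yes refl = contradiction refl d≢c
  ≢⇒other _ (inj₂ d≡b) _ | yes refl = d≡b
  ≢⇒other (inj₁ c≡1) _ _ | no c≢1 = contradiction c≡1 c≢1
  ≢⇒other (inj₂ refl) (inj₁ d≡1) _ | no _ = d≡1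
  ≢⇒other (inj₂ refl) (inj₂ d≡b) d≢c | no _ = contradiction d≡b d≢c

  other-involutive : ∀ {c} → IsLetter b c → other (other c) ≡ c
  other-involutive {c} c∈ = sym (≢⇒other (other-letter c) c∈ (λ eq → other-≢ c (sym eq)))

  other-b : other b ≡ 1
  other-b with b ≟ 1
  ... | yes b≡1 = contradiction b≡1 b≢1
  ... | no _ = refl

  letter-pos : ∀ {c} → IsLetter b c → 1 ≤ c
  letter-pos (inj₁ refl) = ≤-refl
  letter-pos (inj₂ refl) = <⇒≤ 1<b

  letter≤b : ∀ {c} → IsLetter b c → c ≤ b
  letter≤b (inj₁ refl) = <⇒≤ 1<b
  letter≤b (inj₂ refl) = ≤-refl

  <-letters : ∀ {c d} → IsLetter b c → IsLetter b d → c < d → c ≡ 1 × d ≡ b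
  <-letters (inj₁ c≡1) (inj₂ d≡b) _ = c≡1 , d≡b
  <-letters (inj₁ refl) (inj₁ refl) lt = contradiction lt (<-irrefl refl)
  <-letters (inj₂ refl) (inj₂ refl) lt = contradiction lt (<-irrefl refl)
  <-letters (inj₂ refl) (inj₁ refl) lt = contradiction 1<b (<-asym lt)

  ≮1 : ∀ {c} → IsLetter b c → ¬ c < 1
  ≮1 c∈ = <⇒≱ (letter-pos c∈) ∘ ≤-pred

  OverAlph⇒Positive : ∀ {u} → OverAlph b u → Positive u
  OverAlph⇒Positive au i = letter-pos (au i)

  switch : Parity → ℕ → ℕ
  switch p c = pick c (other c) p

  switch-letter : ∀ p {c} → IsLetter b c → IsLetter b (switch p c)
  switch-letter 0ℙ c∈ = c∈
  switch-letter 1ℙ {c} _ = other-letter c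

  switch-suc : ∀ i {c} → IsLetter b c → switch (parity (suc i)) c ≡ other (switch (parity i) c)
  switch-suc i {c} c∈ rewrite parity-suc i with parity i
  ... | 0ℙ = refl
  ... | 1ℙ = sym (other-involutive c∈)

  switch≡self⇒0ℙ : ∀ {p c} → switch p c ≡ c → p ≡ 0ℙ
  switch≡self⇒0ℙ {0ℙ} _ = refl
  switch≡self⇒0ℙ {1ℙ} {c} eq = contradiction eq (other-≢ c)

  switch≡other⇒1ℙ : ∀ {p c} → switch p c ≡ other c → p ≡ 1ℙ
  switch≡other⇒1ℙ {0ℙ} {c} eq = contradiction (sym eq) (other-≢ c)
  switch≡other⇒1ℙ {1ℙ} _ = refl

  module _ {x u : Word} (r : Runs x u) (ax : OverAlph b x) where

    run-letter : ∀ i → x (start r i) ≡ switch (parity i) (x 0)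
    run-letter zero = cong x (start-zero r)
    run-letter (suc i) = begin
      x (start r (suc i))                 ≡⟨ ≢⇒other (ax _) (ax _) (changes r i) ⟩
      other (x (start r i))               ≡⟨ cong other (run-letter i) ⟩
      other (switch (parity i) (x 0))     ≡⟨ switch-suc i (ax 0) ⟨
      switch (parity (suc i)) (x 0)       ∎
      where open ≡-Reasoning

    letter-in-run : ∀ {i p} → start r i ≤ p → p < start r (suc i) → x p ≡ switch (parity i) (x 0)
    letter-in-run {i} {p} lo hi = trans (constant r i p lo hi) (run-letter i)

    long-run-second : ∀ {i} → u i ≡ b → x (start r i + 1) ≡ switch (parity i) (x 0)
    long-run-second {i} long = letter-in-run (m≤m+n _ 1)
      (subst (start r i + 1 <_) (sym (trans (start-suc r i) (cong (start r i +_) long))) (+-monoʳ-< (start r i) 1<b))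

  Δ⁻¹ : ℕ → Word → Word
  Δ⁻¹ a u = decode a (other a) u

  Δ⁻¹-letters : ∀ {a} u → IsLetter b a → OverAlph b (Δ⁻¹ a u)
  Δ⁻¹-letters {a} u a∈ n with decodeF-∈ (suc n) a (other a) u n
  ... | inj₁ eq = subst (IsLetter b) (sym eq) a∈
  ... | inj₂ eq = subst (IsLetter b) (sym eq) (other-letter a)

  Δ⁻¹-head : ∀ a {u} → OverAlph b u → Δ⁻¹ a u 0 ≡ a
  Δ⁻¹-head a au = decode-zero (OverAlph⇒Positive au) a (other a)

  Runs-Δ⁻¹ : ∀ a {u} → Positive u → Runs (Δ⁻¹ a u) u
  Runs-Δ⁻¹ a pos = Runs-decode pos (λ eq → other-≢ a (sym eq))

  module Compare {x u y v : Word} (rx : Runs x u) (ry : Runs y v)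
                 (ax : OverAlph b x) (ay : OverAlph b y) (heads : x 0 ≡ y 0) where

    starts-agree : ∀ i → (∀ k → k < i → u k ≡ v k) → start rx i ≡ start ry i
    starts-agree zero _ = trans (start-zero rx) (sym (start-zero ry))
    starts-agree (suc i) below = begin
      start rx (suc i)        ≡⟨ start-suc rx i ⟩
      start rx i + u i        ≡⟨ cong₂ _+_ (starts-agree i (λ k k<i → below k (<-trans k<i (n<1+n i))))
                                           (below i (n<1+n i)) ⟩
      start ry i + v i        ≡⟨ start-suc ry i ⟨
      start ry (suc i)        ∎
      where open ≡-Reasoning

    run-agree : ∀ {i q} → (∀ k → k < i → u k ≡ v k) → u i ≤ v i →
                start rx i ≤ q → q < start rx (suc i) → x q ≡ y q
    run-agree {i} {q} below ui≤vi lo hi = begin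
      x q                         ≡⟨ letter-in-run rx ax lo hi ⟩
      switch (parity i) (x 0)     ≡⟨ cong (switch (parity i)) heads ⟩
      switch (parity i) (y 0)     ≡⟨ letter-in-run ry ay (subst (_≤ q) same-start lo) hi′ ⟨
      y q                         ∎
      where
      open ≡-Reasoning
      same-start : start rx i ≡ start ry i
      same-start = starts-agree i below
      hi′ : q < start ry (suc i)
      hi′ = <-≤-trans hi (≤-trans (≤-reflexive (start-suc rx i))
              (≤-trans (+-mono-≤ (≤-reflexive same-start) ui≤vi) (≤-reflexive (sym (start-suc ry i)))))

    ≡-from-lengths-below : ∀ p → (∀ k → k < p → u k ≡ v k) → x p ≡ y p
    ≡-from-lengths-below p below with run-of rx p
    ... | i , lo , hi with m≤n⇒m<n∨m≡n (run-index-≤ rx lo)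
    ...   | inj₁ i<p = run-agree (λ k k<i → below k (<-trans k<i i<p)) (≤-reflexive (below i i<p)) lo hi
    ...   | inj₂ refl = begin
      x p                       ≡⟨ cong x p≡start ⟩
      x (start rx p)            ≡⟨ run-letter rx ax p ⟩
      switch (parity p) (x 0)   ≡⟨ cong (switch (parity p)) heads ⟩
      switch (parity p) (y 0)   ≡⟨ run-letter ry ay p ⟨
      y (start ry p)            ≡⟨ cong y (trans (sym (starts-agree p below)) (sym p≡start)) ⟩
      y p                       ∎
      where
      open ≡-Reasoning
      p≡start : p ≡ start rx p
      p≡start = ≤-antisym (≤start rx p) lo

    module _ {j : ℕ} (below : ∀ k → k < j → u k ≡ v k) (shorter : u j < v j) where

      private
        end : ℕ
        end = start rx (suc j)

      agree-before-end : ∀ q → q < end → x q ≡ y q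
      agree-before-end q q<end with run-of rx q
      ... | i , lo , hi with m≤n⇒m<n∨m≡n i≤j
        where
        i≤j : i ≤ j
        i≤j = ≮⇒≥ λ j<i → <-irrefl refl (<-≤-trans q<end (≤-trans (start-mono-≤ rx j<i) lo))
      ...   | inj₁ i<j = run-agree (λ k k<i → below k (<-trans k<i i<j)) (≤-reflexive (below i i<j)) lo hi
      ...   | inj₂ refl = run-agree below (<⇒≤ shorter) lo hi

      y-at-end : y end ≡ switch (parity j) (x 0)
      y-at-end = trans (letter-in-run ry ay lo hi) (cong (switch (parity j)) (sym heads))
        where
        end≡ : end ≡ start ry j + u j
        end≡ = trans (start-suc rx j) (cong (_+ u j) (starts-agree j below))
        lo : start ry j ≤ end
        lo = subst (start ry j ≤_) (sym end≡) (m≤m+n _ _)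
        hi : end < start ry (suc j)
        hi = subst₂ _<_ (sym end≡) (sym (start-suc ry j)) (+-monoʳ-< (start ry j) shorter)

      x-at-end : x end ≡ other (switch (parity j) (x 0))
      x-at-end = trans (run-letter rx ax (suc j)) (switch-suc j (ax 0))

      shorter-1-run⇒>lex : switch (parity j) (x 0) ≡ 1 → y <lex x
      shorter-1-run⇒>lex letter≡1 = end , (λ q q<end → sym (agree-before-end q q<end)) ,
        subst₂ _<_ (sym (trans y-at-end letter≡1)) (sym (trans x-at-end (cong other letter≡1))) 1<b

      shorter-b-run⇒<lex : switch (parity j) (x 0) ≡ b → x <lex y
      shorter-b-run⇒<lex letter≡b = end , agree-before-end ,
        subst₂ _<_ (sym (trans x-at-end (trans (cong other letter≡b) other-b)))
                   (sym (trans y-at-end letter≡b)) 1<b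

  <lex⇒run-difference : ∀ {x u y v} → Runs x u → Runs y v → OverAlph b x → OverAlph b y → x 0 ≡ y 0 →
    x <lex y → ∃ λ j → (∀ k → k < j → u k ≡ v k) ×
      (u j < v j × switch (parity j) (x 0) ≡ b ⊎ v j < u j × switch (parity j) (x 0) ≡ 1)
  <lex⇒run-difference {x} {u} {y} {v} rx ry ax ay heads x<y@(p , _ , xp<yp) with first-difference u v p
  ... | inj₁ below = contradiction (X.≡-from-lengths-below p below) (<⇒≢ xp<yp)
    where module X = Compare rx ry ax ay heads
  ... | inj₂ (j , below , ne) with <-cmp (u j) (v j) | switch-letter (parity j) (ax 0)
  ...   | tri≈ _ eq _ | _ = contradiction eq ne
  ...   | tri< lt _ _ | inj₂ letter≡b = j , below , inj₁ (lt , letter≡b)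
  ...   | tri< lt _ _ | inj₁ letter≡1 = contradiction (X.shorter-1-run⇒>lex below lt letter≡1) (<lex-asym x<y)
    where module X = Compare rx ry ax ay heads
  ...   | tri> _ _ gt | inj₁ letter≡1 = j , below , inj₂ (gt , letter≡1)
  ...   | tri> _ _ gt | inj₂ letter≡b = contradiction
      (Y.shorter-b-run⇒<lex (λ k k<j → sym (below k k<j)) gt
        (trans (cong (switch (parity j)) (sym heads)) letter≡b))
      (<lex-asym x<y)
    where module Y = Compare ry rx ay ax (sym heads)

  ≈Δ⁻¹ : ∀ {x u} → Runs x u → OverAlph b x → x ≈w Δ⁻¹ (x 0) u
  ≈Δ⁻¹ {x} {u} r ax p = X.≡-from-lengths-below p (λ _ _ → refl)
    where
    module X = Compare r (Runs-Δ⁻¹ (x 0) (length-pos r)) ax (Δ⁻¹-letters u (ax 0))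
                       (sym (decode-zero (length-pos r) (x 0) (other (x 0))))

  cons : Word → (ℕ → Word) → ℕ → Word
  cons x W zero = x
  cons x W (suc k) = W k

  tower-tail : ∀ {w W} → DeltaTower b w W → DeltaTower b (W 1) (λ k → W (suc k))
  tower-tail (_ , letters , runs) = (λ _ → refl) , (λ k → letters (suc k)) , (λ k → runs (suc k))

  tower-cons : ∀ {x w W} → OverAlph b x → Runs x (W 0) → DeltaTower b w W → DeltaTower b x (cons x W)
  tower-cons {x} {w} {W} ax r (_ , letters , runs) = (λ _ → refl) , letters′ , runs′
    where
    letters′ : ∀ k → OverAlph b (cons x W k)
    letters′ zero = ax
    letters′ (suc k) = letters k
    runs′ : ∀ k → IsΔ (cons x W k) (cons x W (suc k))
    runs′ zero = Runs⇒IsΔ r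
    runs′ (suc k) = runs k

  Δ⁻¹-tower : ∀ {w W} a → IsLetter b a → DeltaTower b w W →
              DeltaTower b (Δ⁻¹ a (W 0)) (cons (Δ⁻¹ a (W 0)) W)
  Δ⁻¹-tower {W = W} a a∈ t@(_ , letters , _) =
    tower-cons (Δ⁻¹-letters (W 0) a∈) (Runs-Δ⁻¹ a (OverAlph⇒Positive (letters 0))) t

  alternating-tower : ∀ {X Y} → Runs X Y → Runs Y X → OverAlph b X → OverAlph b Y →
                      DeltaTower b X (alternating X Y)
  alternating-tower {X} {Y} rXY rYX aX aY =
    (λ _ → refl) , alternating-preserves (OverAlph b) aX aY , λ k → Runs⇒IsΔ (runs rXY rYX k)
    where
    runs : ∀ {X Y} → Runs X Y → Runs Y X → ∀ k → Runs (alternating X Y k) (alternating X Y (suc k))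
    runs rXY rYX zero = rXY
    runs rXY rYX (suc k) = runs rYX rXY k

  towers-≈-by-heads : ∀ {w w′ T T′} → DeltaTower b w T → DeltaTower b w′ T′ →
    (∀ k → T k 0 ≡ T′ k 0) → ∀ k → T k ≈w T′ k
  towers-≈-by-heads {T = T} {T′} (_ , aT , rT) (_ , aT′ , rT′) heads k p =
    <-rec (λ p → ∀ k → T k p ≡ T′ k p) step p k
    where
    step : ∀ p → (∀ {q} → q < p → ∀ k → T k q ≡ T′ k q) → ∀ k → T k p ≡ T′ k p
    step p below k = Compare.≡-from-lengths-below (IsΔ⇒Runs (rT k)) (IsΔ⇒Runs (rT′ k)) (aT k) (aT′ k) (heads k)
                       p (λ q q<p → below q<p (suc k))

module OddAlphabet {b : ℕ} (1<b : 1 < b) (b-odd : parity b ≡ 1ℙ) where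
  open Alphabet 1<b

  letter-odd : ∀ {c} → IsLetter b c → parity c ≡ 1ℙ
  letter-odd (inj₁ refl) = refl
  letter-odd (inj₂ refl) = b-odd

  start-parity-letters : ∀ {x u} (r : Runs x u) → OverAlph b u → ∀ i → parity (start r i) ≡ parity i
  start-parity-letters r au = start-parity r (λ i → letter-odd (au i))

  Δ⁻¹-1∘Δ⁻¹-b-monotone : ∀ {u v} → OverAlph b u → OverAlph b v → u <lex v →
                         Δ⁻¹ 1 (Δ⁻¹ b u) <lex Δ⁻¹ 1 (Δ⁻¹ b v)
  Δ⁻¹-1∘Δ⁻¹-b-monotone {u} {v} au av (j , below , shorter) = by-parity (parity j) refl
    where
    x = Δ⁻¹ b u
    y = Δ⁻¹ b v
    ax = Δ⁻¹-letters u (inj₂ refl)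
    ay = Δ⁻¹-letters v (inj₂ refl)
    rx = Runs-Δ⁻¹ b (OverAlph⇒Positive au)
    module C = Compare rx (Runs-Δ⁻¹ b (OverAlph⇒Positive av)) ax ay
                       (trans (Δ⁻¹-head b au) (sym (Δ⁻¹-head b av)))
    end = start rx (suc j)
    x-end : x end ≡ other (switch (parity j) b)
    x-end = trans (C.x-at-end below shorter) (cong (λ c → other (switch (parity j) c)) (Δ⁻¹-head b au))
    y-end : y end ≡ switch (parity j) b
    y-end = trans (C.y-at-end below shorter) (cong (switch (parity j)) (Δ⁻¹-head b au))
    end-parity : parity end ≡ parity j ⁻¹
    end-parity = trans (start-parity-letters rx au (suc j)) (parity-suc j)
    module D = Compare (Runs-Δ⁻¹ 1 (OverAlph⇒Positive ax)) (Runs-Δ⁻¹ 1 (OverAlph⇒Positive ay))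
                       (Δ⁻¹-letters x (inj₁ refl)) (Δ⁻¹-letters y (inj₁ refl))
                       (trans (Δ⁻¹-head 1 ax) (sym (Δ⁻¹-head 1 ay)))
    module D′ = Compare (Runs-Δ⁻¹ 1 (OverAlph⇒Positive ay)) (Runs-Δ⁻¹ 1 (OverAlph⇒Positive ax))
                        (Δ⁻¹-letters y (inj₁ refl)) (Δ⁻¹-letters x (inj₁ refl))
                        (trans (Δ⁻¹-head 1 ay) (sym (Δ⁻¹-head 1 ax)))
    by-parity : ∀ p → parity j ≡ p → Δ⁻¹ 1 x <lex Δ⁻¹ 1 y
    by-parity 0ℙ j-even = D.shorter-b-run⇒<lex (C.agree-before-end below shorter)
      (subst₂ _<_ (sym (trans x-end (trans (cong (λ p → other (switch p b)) j-even) other-b)))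
                  (sym (trans y-end (cong (λ p → switch p b) j-even))) 1<b)
      (trans (cong (λ p → switch p (Δ⁻¹ 1 x 0)) (trans end-parity (cong _⁻¹ j-even)))
             (cong other (Δ⁻¹-head 1 ax)))
    by-parity 1ℙ j-odd = D′.shorter-1-run⇒>lex (λ q q<end → sym (C.agree-before-end below shorter q q<end))
      (subst₂ _<_ (sym (trans y-end (trans (cong (λ p → switch p b) j-odd) other-b)))
                  (sym (trans x-end (trans (cong (λ p → other (switch p b)) j-odd) (cong other other-b)))) 1<b)
      (trans (cong (λ p → switch p (Δ⁻¹ 1 y 0)) (trans end-parity (cong _⁻¹ j-odd))) (Δ⁻¹-head 1 ay))

  module MinimalSmooth {m : Word} {W : ℕ → Word} (tower : DeltaTower b m W)
                       (minimal : ∀ w → Smooth b w → m ≤lex w) where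

    private
      W0≈m : W 0 ≈w m
      W0≈m = proj₁ tower
      letters : ∀ k → OverAlph b (W k)
      letters = proj₁ (proj₂ tower)
      runs : ∀ k → Runs (W k) (W (suc k))
      runs k = IsΔ⇒Runs (proj₂ (proj₂ tower) k)
      tower₀ : DeltaTower b (W 0) W
      tower₀ = (λ _ → refl) , letters , proj₂ (proj₂ tower)
      smooth-Δ⁻¹-1∘Δ⁻¹-b : Smooth b (Δ⁻¹ 1 (Δ⁻¹ b (W 0)))
      smooth-Δ⁻¹-1∘Δ⁻¹-b = _ , Δ⁻¹-tower 1 (inj₁ refl) (Δ⁻¹-tower b (inj₂ refl) tower₀)

    ≮minimal : ∀ {w} → Smooth b w → ¬ w <lex W 0
    ≮minimal sw w<W0 = ≤lex⇒≯lex (minimal _ sw) (<lex-resp-≈ (λ _ → refl) W0≈m w<W0)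

    head≡1 : W 0 0 ≡ 1
    head≡1 with letters 0 0
    ... | inj₁ W00≡1 = W00≡1
    ... | inj₂ W00≡b = contradiction
      (0 , (λ _ ()) , subst₂ _<_ (sym (Δ⁻¹-head 1 (letters 0))) (sym W00≡b) 1<b)
      (≮minimal (_ , Δ⁻¹-tower 1 (inj₁ refl) tower₀))

    -- Otherwise m = 1b…, whereas the smooth word Δ⁻¹ 1 (Δ⁻¹ b (W 0)) starts with 11.
    Δ-head≡b : W 1 0 ≡ b
    Δ-head≡b with letters 1 0
    ... | inj₂ W10≡b = W10≡b
    ... | inj₁ W10≡1 = contradiction (1 , agree , subst₂ _<_ (sym candidate-1) (sym W01≡b) 1<b)
                                     (≮minimal smooth-Δ⁻¹-1∘Δ⁻¹-b)
      where
      lengths = Δ⁻¹ b (W 0)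
      lengths-pos : Positive lengths
      lengths-pos = OverAlph⇒Positive (Δ⁻¹-letters (W 0) (inj₂ refl))
      candidate-1 : Δ⁻¹ 1 lengths 1 ≡ 1
      candidate-1 = decode-in-run lengths-pos 1 b 0 1 z≤n (subst (1 <_) (sym (Δ⁻¹-head b (letters 0))) 1<b)
      W01≡b : W 0 1 ≡ b
      W01≡b = trans (cong (W 0) (sym (start-one (runs 0) W10≡1)))
                    (trans (run-letter (runs 0) (letters 0) 1) (cong other head≡1))
      agree : ∀ k → k < 1 → Δ⁻¹ 1 lengths k ≡ W 0 k
      agree zero _ = trans (Δ⁻¹-head 1 (Δ⁻¹-letters (W 0) (inj₂ refl))) (sym head≡1)
      agree (suc _) (s≤s ())

    W0≈Δ⁻¹-1∘Δ⁻¹-b-W2 : W 0 ≈w Δ⁻¹ 1 (Δ⁻¹ b (W 2))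
    W0≈Δ⁻¹-1∘Δ⁻¹-b-W2 = ≈w-trans
      (subst (λ a → W 0 ≈w Δ⁻¹ a (W 1)) head≡1 (≈Δ⁻¹ (runs 0) (letters 0)))
      (decode-cong 1 b (subst (λ a → W 1 ≈w Δ⁻¹ a (W 2)) Δ-head≡b (≈Δ⁻¹ (runs 1) (letters 1))))

    Δ²-fixed : W 2 ≈w W 0
    Δ²-fixed = ≮lex∧≯lex⇒≈w (≮minimal (_ , tower-tail (tower-tail tower)))
      λ W0<W2 → ≮minimal smooth-Δ⁻¹-1∘Δ⁻¹-b
        (<lex-resp-≈ (λ _ → refl) (≈w-sym W0≈Δ⁻¹-1∘Δ⁻¹-b-W2)
                     (Δ⁻¹-1∘Δ⁻¹-b-monotone (letters 0) (letters 2) W0<W2))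

    runs-Δ-back : Runs (W 1) (W 0)
    runs-Δ-back = Runs-resp-lengths Δ²-fixed (runs 1)

    periodic-tower : DeltaTower b m (alternating (W 0) (W 1))
    periodic-tower = W0≈m , proj₂ (alternating-tower (runs 0) runs-Δ-back (letters 0) (letters 1))

  module EvenShift {x u : Word} (r : Runs x u) (ax : OverAlph b x) (au : OverAlph b u)
                   (i : ℕ) (i-even : parity i ≡ 0ℙ) where

    start-even : parity (start r i) ≡ 0ℙ
    start-even = trans (start-parity-letters r au i) i-even

    start-pos : 1 ≤ i → 1 ≤ start r i
    start-pos 1≤i = ≤-trans 1≤i (≤start r i)

    same-head : x 0 ≡ suffix (start r i) x 0
    same-head = sym (trans (cong x (+-identityʳ _))
                           (trans (run-letter r ax i) (cong (λ p → switch p (x 0)) i-even)))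

    shifted-letters : OverAlph b (suffix (start r i) x)
    shifted-letters n = ax (start r i + n)

    module Forward = Compare r (Runs-suffix r i) ax shifted-letters same-head
    module Backward = Compare (Runs-suffix r i) r shifted-letters ax (sym same-head)

    shift-parity : ∀ j → parity (i + j) ≡ parity j
    shift-parity j = parity-+-even i j i-even

  record EvenMin (u : Word) : Set where
    field
      even-1 : ∀ p → parity p ≡ 0ℙ → u p ≡ 1
      below-even-suffixes : ∀ k → 1 ≤ k → parity k ≡ 0ℙ → u <lex suffix k u

  record EvenMax (v : Word) : Set where
    field
      head-b : v 0 ≡ b
      odd-1 : ∀ p → parity p ≡ 1ℙ → v p ≡ 1
      above-even-suffixes : ∀ k → 1 ≤ k → parity k ≡ 0ℙ → suffix k v <lex v

  -- If u 1 were b, comparing u with its even suffixes would make every odd letter b, so that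
  -- u = (1b)^ω = suffix 2 u.
  EvenMin⇒second-1 : ∀ {u} → OverAlph b u → EvenMin u → u 1 ≡ 1
  EvenMin⇒second-1 {u} au min with au 1
  ... | inj₁ u1≡1 = u1≡1
  ... | inj₂ u1≡b = contradiction (below-even-suffixes 2 (s≤s z≤n) refl) (<lex-irrefl periodic)
    where
    open EvenMin min
    odd-b : ∀ k → parity k ≡ 0ℙ → u (suc k) ≡ b
    odd-b zero _ = u1≡b
    odd-b k@(suc _) k-even with au (suc k)
    ... | inj₂ eq = eq
    ... | inj₁ eq = contradiction (1 , agree , subst₂ _<_ (sym (trans (cong u (+-comm k 1)) eq)) (sym u1≡b) 1<b)
                                  (<lex-asym (below-even-suffixes k (s≤s z≤n) k-even))
      where
      agree : ∀ j → j < 1 → suffix k u j ≡ u j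
      agree zero _ = trans (cong u (+-identityʳ k)) (trans (even-1 k k-even) (sym (even-1 0 refl)))
      agree (suc _) (s≤s ())
    periodic : u ≈w suffix 2 u
    periodic zero = trans (even-1 0 refl) (sym (even-1 2 refl))
    periodic (suc n) with parity n in pn
    ... | 0ℙ = trans (odd-b n pn) (sym (odd-b (2 + n) pn))
    ... | 1ℙ = trans (even-1 (suc n) (trans (parity-suc n) (cong _⁻¹ pn)))
                     (sym (even-1 (3 + n) (trans (parity-suc n) (cong _⁻¹ pn))))

  EvenMin-Δ : ∀ {u v} → Runs u v → OverAlph b u → OverAlph b v → EvenMin u → EvenMax v
  EvenMin-Δ {u} {v} r au av min = record { head-b = head-b ; odd-1 = odd-1 ; above-even-suffixes = above }
    where
    open EvenMin min
    u0≡1 : u 0 ≡ 1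
    u0≡1 = even-1 0 refl
    head-b : v 0 ≡ b
    head-b with av 0
    ... | inj₂ v0≡b = v0≡b
    ... | inj₁ v0≡1 = contradiction (trans (sym u1≡b) (EvenMin⇒second-1 au min)) b≢1
      where
      u1≡b : u 1 ≡ b
      u1≡b = trans (cong u (sym (start-one r v0≡1))) (trans (run-letter r au 1) (cong other u0≡1))
    odd-1 : ∀ p → parity p ≡ 1ℙ → v p ≡ 1
    odd-1 p p-odd with av p
    ... | inj₁ vp≡1 = vp≡1
    ... | inj₂ vp≡b = contradiction (trans (sym second-b) second-1) b≢1
      where
      second-b : u (start r p + 1) ≡ b
      second-b = trans (long-run-second r au vp≡b) (trans (cong (λ q → switch q (u 0)) p-odd) (cong other u0≡1))
      second-1 : u (start r p + 1) ≡ 1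
      second-1 = even-1 _ (trans (parity-+1 (start r p)) (cong _⁻¹ (trans (start-parity-letters r av p) p-odd)))
    above : ∀ k → 1 ≤ k → parity k ≡ 0ℙ → suffix k v <lex v
    above k 1≤k k-even with <lex⇒run-difference r (Runs-suffix r k) au E.shifted-letters E.same-head
                             (below-even-suffixes _ (E.start-pos 1≤k) E.start-even)
      where module E = EvenShift r au av k k-even
    ... | j , agree , inj₂ (shifted<v , _) = j , (λ n n<j → sym (agree n n<j)) , shifted<v
    ... | j , agree , inj₁ (v<shifted , letter≡b) =
      contradiction (subst₂ _<_ (odd-1 j j-odd) (odd-1 (k + j) shifted-odd) v<shifted) (<-irrefl refl)
      where
      j-odd : parity j ≡ 1ℙ
      j-odd = switch≡other⇒1ℙ (trans letter≡b (cong other (sym u0≡1)))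
      shifted-odd : parity (k + j) ≡ 1ℙ
      shifted-odd = trans (EvenShift.shift-parity r au av k k-even j) j-odd

  EvenMax-Δ : ∀ {v x} → Runs v x → OverAlph b v → OverAlph b x → EvenMax v → EvenMin x
  EvenMax-Δ {v} {x} r av ax max = record { even-1 = even-1 ; below-even-suffixes = below }
    where
    open EvenMax max
    even-1 : ∀ p → parity p ≡ 0ℙ → x p ≡ 1
    even-1 p p-even with ax p
    ... | inj₁ xp≡1 = xp≡1
    ... | inj₂ xp≡b = contradiction (trans (sym second-b) second-1) b≢1
      where
      second-b : v (start r p + 1) ≡ b
      second-b = trans (long-run-second r av xp≡b) (trans (cong (λ q → switch q (v 0)) p-even) head-b)
      second-1 : v (start r p + 1) ≡ 1
      second-1 = odd-1 _ (trans (parity-+1 (start r p)) (cong _⁻¹ (trans (start-parity-letters r ax p) p-even)))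
    below : ∀ k → 1 ≤ k → parity k ≡ 0ℙ → x <lex suffix k x
    below k 1≤k k-even with <lex⇒run-difference (Runs-suffix r k) r E.shifted-letters av (sym E.same-head)
                             (above-even-suffixes _ (E.start-pos 1≤k) E.start-even)
      where module E = EvenShift r av ax k k-even
    ... | j , agree , inj₂ (x<shifted , _) = j , (λ n n<j → sym (agree n n<j)) , x<shifted
    ... | j , agree , inj₁ (shifted<x , letter≡b) =
      contradiction (subst (x (k + j) <_) (even-1 j j-even) shifted<x) (≮1 (ax (k + j)))
      where
      j-even : parity j ≡ 0ℙ
      j-even = switch≡self⇒0ℙ (trans letter≡b (sym (trans (sym (EvenShift.same-head r av ax k k-even)) head-b)))

  Lyndon-Δ : ∀ {w u} → Runs w u → OverAlph b w → OverAlph b u → InfLyndon w → w 0 ≡ 1 → u 0 ≡ 1 →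
             EvenMin u
  Lyndon-Δ {w} {u} r aw au lyndon w0≡1 u0≡1 = record { even-1 = even-1 ; below-even-suffixes = below }
    where
    w1≡b : w 1 ≡ b
    w1≡b = trans (cong w (sym (start-one r u0≡1))) (trans (run-letter r aw 1) (cong other w0≡1))
    even-1 : ∀ p → parity p ≡ 0ℙ → u p ≡ 1
    even-1 zero _ = u0≡1
    even-1 p@(suc _) p-even with au p
    ... | inj₁ up≡1 = up≡1
    ... | inj₂ up≡b = contradiction (1 , agree , subst₂ _<_ (sym second) (sym w1≡b) 1<b)
                                    (<lex-asym (lyndon _ (E.start-pos (s≤s z≤n))))
      where
      module E = EvenShift r aw au p p-even
      agree : ∀ j → j < 1 → suffix (start r p) w j ≡ w j
      agree zero _ = sym E.same-head
      agree (suc _) (s≤s ())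
      second : suffix (start r p) w 1 ≡ 1
      second = trans (long-run-second r aw up≡b) (trans (cong (λ q → switch q (w 0)) p-even) w0≡1)
    below : ∀ k → 1 ≤ k → parity k ≡ 0ℙ → u <lex suffix k u
    below k 1≤k k-even with <lex⇒run-difference r (Runs-suffix r k) aw E.shifted-letters E.same-head
                             (lyndon _ (E.start-pos 1≤k))
      where module E = EvenShift r aw au k k-even
    ... | j , agree , inj₁ (u<shifted , _) = j , agree , u<shifted
    ... | j , agree , inj₂ (shifted<u , letter≡1) =
      contradiction (subst (u (k + j) <_) (even-1 j j-even) shifted<u) (≮1 (au (k + j)))
      where
      j-even : parity j ≡ 0ℙ
      j-even = switch≡self⇒0ℙ (trans letter≡1 (sym w0≡1))

  letter-by-parity : ∀ {x u} (r : Runs x u) → OverAlph b x → OverAlph b u → ∀ p →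
    (∀ i → i < p → parity i ≢ parity p → u i ≡ 1) → x p ≡ switch (parity p) (x 0)
  letter-by-parity r ax au p short with run-of r p
  ... | i , lo , hi with parity i ≟ℙ parity p
  ...   | yes same = trans (letter-in-run r ax lo hi) (cong (λ q → switch q _) same)
  ...   | no differ = contradiction
    (trans (cong parity (unit-run r lo hi (short i i<p differ))) (start-parity-letters r au i)) (differ ∘ sym)
    where
    i<p : i < p
    i<p = ≤∧≢⇒< (run-index-≤ r lo) (λ i≡p → differ (cong parity i≡p))

  module Periodic {X Y : Word} (rXY : Runs X Y) (rYX : Runs Y X) (aX : OverAlph b X) (aY : OverAlph b Y)
                  (X0≡1 : X 0 ≡ 1) (Y0≡b : Y 0 ≡ b) where

    private
      EvenOdd : ℕ → Set
      EvenOdd p = (parity p ≡ 0ℙ → X p ≡ 1) × (parity p ≡ 1ℙ → Y p ≡ 1)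

      even-odd : ∀ p → EvenOdd p
      even-odd = <-rec EvenOdd λ p below →
          (λ p-even → trans
            (letter-by-parity rXY aX aY p (λ i i<p differ → proj₂ (below i<p) (flip-parity differ p-even)))
            (trans (cong (λ q → switch q (X 0)) p-even) X0≡1))
        , (λ p-odd → trans
            (letter-by-parity rYX aY aX p (λ i i<p differ → proj₁ (below i<p) (flip-parity differ p-odd)))
            (trans (cong (λ q → switch q (Y 0)) p-odd) (trans (cong other Y0≡b) other-b)))
        where
        flip-parity : ∀ {p q r : Parity} → p ≢ q → q ≡ r → p ≡ r ⁻¹
        flip-parity differ refl = ≢⇒≡⁻¹ differ

    X-even-1 : ∀ p → parity p ≡ 0ℙ → X p ≡ 1
    X-even-1 p = proj₁ (even-odd p)

    Y-odd-1 : ∀ p → parity p ≡ 1ℙ → Y p ≡ 1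
    Y-odd-1 p = proj₂ (even-odd p)

    X-prefix : ∀ q → q < b → X q ≡ 1
    X-prefix q q<b = trans (letter-in-run rXY aX (subst (_≤ q) (sym (start-zero rXY)) z≤n) q<start1) X0≡1
      where
      q<start1 : q < start rXY 1
      q<start1 = subst (q <_) (sym (trans (start-suc rXY 0) (cong₂ _+_ (start-zero rXY) Y0≡b))) q<b

    XBelow YAbove : ℕ → Set
    XBelow n = 1 ≤ n → parity n ≡ 0ℙ → X <lex suffix n X
    YAbove n = 1 ≤ n → parity n ≡ 0ℙ → suffix n Y <lex Y

    even-run : ∀ {n i} → parity n ≡ 0ℙ → start rXY i ≤ n → n < start rXY (suc i) → parity i ≡ 0ℙ
    even-run {n} n-even lo hi =
      switch≡self⇒0ℙ (trans (sym (letter-in-run rXY aX lo hi)) (trans (X-even-1 n n-even) (sym X0≡1)))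

    -- X starts with b ones, more than remain of the run of ones containing n.
    X-below-inside-run : ∀ {n i} → parity n ≡ 0ℙ → start rXY i < n → n < start rXY (suc i) →
                         X <lex suffix n X
    X-below-inside-run {n} {i} n-even lo hi = q , agree , subst₂ _<_ (sym (X-prefix q q<b)) (sym X-end) 1<b
      where
      i-even : parity i ≡ 0ℙ
      i-even = even-run n-even (<⇒≤ lo) hi
      q = start rXY (suc i) ∸ n
      n+q : n + q ≡ start rXY (suc i)
      n+q = m+[n∸m]≡n (<⇒≤ hi)
      q<b : q < b
      q<b = +-cancelˡ-< n q b (subst (_< n + b) (sym n+q)
              (subst (_< n + b) (sym (start-suc rXY i)) (+-mono-<-≤ lo (letter≤b (aY i)))))
      agree : ∀ k → k < q → X k ≡ X (n + k)
      agree k k<q = trans (X-prefix k (<-trans k<q q<b)) (sym (trans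
        (letter-in-run rXY aX (≤-trans (<⇒≤ lo) (m≤m+n n k)) (subst (n + k <_) n+q (+-monoʳ-< n k<q)))
        (trans (cong (λ p → switch p (X 0)) i-even) X0≡1)))
      X-end : X (n + q) ≡ b
      X-end = trans (cong X n+q) (trans (run-letter rXY aX (suc i))
                (trans (switch-suc i (aX 0)) (cong other (trans (cong (λ p → switch p (X 0)) i-even) X0≡1))))

    X-below-at-run-start : ∀ {n i} → parity i ≡ 0ℙ → start rXY i ≡ n → suffix i Y <lex Y →
                           X <lex suffix n X
    X-below-at-run-start {n} {i} i-even start≡n (j , agree , shifted<Y) =
      subst (λ k → X <lex suffix k X) start≡n (E.Backward.shorter-1-run⇒>lex agree shifted<Y letter≡1)
      where
      module E = EvenShift rXY aX aY i i-even
      j-even : parity j ≡ 0ℙ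
      j-even = ≢⇒≡⁻¹ λ j-odd → b≢1 (trans (sym (proj₂ (<-letters (aY (i + j)) (aY j) shifted<Y)))
                                         (Y-odd-1 j j-odd))
      letter≡1 : switch (parity j) (suffix (start rXY i) X 0) ≡ 1
      letter≡1 = trans (cong (λ p → switch p _) j-even) (trans (sym E.same-head) X0≡1)

    Y-above-at-run-start : ∀ {n i} → parity i ≡ 0ℙ → start rYX i ≡ n → X <lex suffix i X →
                           suffix n Y <lex Y
    Y-above-at-run-start {n} {i} i-even start≡n (j , agree , X<shifted) =
      subst (λ k → suffix k Y <lex Y) start≡n (E.Forward.shorter-1-run⇒>lex agree X<shifted letter≡1)
      where
      module E = EvenShift rYX aY aX i i-even
      j-odd : parity j ≡ 1ℙ
      j-odd = ≢⇒≡⁻¹ λ j-even → b≢1 (trans (sym (proj₂ (<-letters (aX j) (aX (i + j)) X<shifted)))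
                                          (X-even-1 (i + j) (trans (E.shift-parity j) j-even)))
      letter≡1 : switch (parity j) (Y 0) ≡ 1
      letter≡1 = trans (cong (λ p → switch p (Y 0)) j-odd) (trans (cong other Y0≡b) other-b)

    X-below : ∀ n → (∀ {k} → k < n → YAbove k) → XBelow n
    X-below n above 1≤n n-even with run-of rXY n
    ... | i , lo , hi with start rXY i ≟ n
    ...   | no start≢n = X-below-inside-run n-even (≤∧≢⇒< lo start≢n) hi
    ...   | yes start≡n = X-below-at-run-start i-even start≡n (above i<n 1≤i i-even)
      where
      i-even : parity i ≡ 0ℙ
      i-even = even-run n-even lo hi
      1≤i : 1 ≤ i
      1≤i = start-pos⇒index-pos rXY (subst (1 ≤_) (sym start≡n) 1≤n)
      i<n : i < n
      i<n = subst (i <_) start≡n (index<start rXY (subst (2 ≤_) (sym Y0≡b) 1<b) i 1≤i)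

    Y-above : ∀ n → (∀ {k} → k ≤ n → XBelow k) → YAbove n
    Y-above n below 1≤n n-even with aY n
    ... | inj₁ Yn≡1 = 0 , (λ _ ()) , subst₂ _<_ (sym (trans (cong Y (+-identityʳ n)) Yn≡1)) (sym Y0≡b) 1<b
    ... | inj₂ Yn≡b with run-of rYX n
    ...   | i , lo , hi = Y-above-at-run-start i-even (sym n≡start) (below (run-index-≤ rYX lo) 1≤i i-even)
      where
      i-even : parity i ≡ 0ℙ
      i-even = switch≡self⇒0ℙ (trans (sym (letter-in-run rYX aY lo hi)) (trans Yn≡b (sym Y0≡b)))
      n≡start : n ≡ start rYX i
      n≡start = unit-run rYX lo hi (X-even-1 i i-even)
      1≤i : 1 ≤ i
      1≤i = start-pos⇒index-pos rYX (subst (1 ≤_) n≡start 1≤n)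

    private
      below-above : ∀ n → XBelow n × YAbove n
      below-above = <-rec _ λ n smaller →
        let below-n = X-below n (λ k<n → proj₂ (smaller k<n))
        in below-n , Y-above n λ k≤n →
             [ (λ k<n → proj₁ (smaller k<n)) , (λ { refl → below-n }) ]′ (m≤n⇒m<n∨m≡n k≤n)

    X-EvenMin : EvenMin X
    X-EvenMin = record { even-1 = X-even-1 ; below-even-suffixes = λ n → proj₁ (below-above n) }


  module _ {u : Word} (au : OverAlph b u) (min : EvenMin u) where
    open EvenMin min

    private
      x = Δ⁻¹ 1 u
      ax : OverAlph b x
      ax = Δ⁻¹-letters u (inj₁ refl)
      r : Runs x u
      r = Runs-Δ⁻¹ 1 (OverAlph⇒Positive au)
      x0≡1 : x 0 ≡ 1
      x0≡1 = Δ⁻¹-head 1 au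

      below-at-run-start : ∀ {n i} → parity i ≡ 0ℙ → start r i ≡ n → u <lex suffix i u →
                           x <lex suffix n x
      below-at-run-start {n} {i} i-even start≡n (j , agree , u<shifted) =
        subst (λ n → x <lex suffix n x) start≡n (E.Forward.shorter-b-run⇒<lex agree u<shifted letter≡b)
        where
        module E = EvenShift r ax au i i-even
        j-odd : parity j ≡ 1ℙ
        j-odd = ≢⇒≡⁻¹ λ j-even → b≢1 (trans (sym (proj₂ (<-letters (au j) (au (i + j)) u<shifted)))
                                            (even-1 (i + j) (trans (E.shift-parity j) j-even)))
        letter≡b : switch (parity j) (x 0) ≡ b
        letter≡b = trans (cong (λ p → switch p (x 0)) j-odd) (cong other x0≡1)

    Δ⁻¹-1-Lyndon : InfLyndon (Δ⁻¹ 1 u)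
    Δ⁻¹-1-Lyndon k 1≤k with ax k
    ... | inj₂ xk≡b = 0 , (λ _ ()) , subst₂ _<_ (sym x0≡1) (sym (trans (cong x (+-identityʳ k)) xk≡b)) 1<b
    ... | inj₁ xk≡1 with run-of r k
    ...   | i , lo , hi = below-at-run-start i-even (sym k≡start) (below-even-suffixes i 1≤i i-even)
      where
      i-even : parity i ≡ 0ℙ
      i-even = switch≡self⇒0ℙ (trans (sym (letter-in-run r ax lo hi)) (trans xk≡1 (sym x0≡1)))
      k≡start : k ≡ start r i
      k≡start = unit-run r lo hi (even-1 i i-even)
      1≤i : 1 ≤ i
      1≤i = start-pos⇒index-pos r (subst (1 ≤_) k≡start 1≤k)

  module _ {m : Word} {W : ℕ → Word} (tower : DeltaTower b m W)
           (minimal : ∀ w → Smooth b w → m ≤lex w) where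
    open MinimalSmooth tower minimal

    private
      letters : ∀ k → OverAlph b (W k)
      letters = proj₁ (proj₂ tower)
      runs : ∀ k → Runs (W k) (W (suc k))
      runs k = IsΔ⇒Runs (proj₂ (proj₂ tower) k)
      module P = Periodic (runs 0) runs-Δ-back (letters 0) (letters 1) head≡1 Δ-head≡b

    Δinv₁-minimal-smooth : ∀ {w} → w ≈w Δinv₁ b m → Smooth b w × InfLyndon w × PhiStarts11 b w
    Δinv₁-minimal-smooth {w} w≈ =
      (_ , tw) , InfLyndon-resp-≈ (≈w-sym w≈x) (Δ⁻¹-1-Lyndon (letters 0) P.X-EvenMin) ,
      (_ , tw , trans (w≈x 0) (Δ⁻¹-head 1 (letters 0)) , head≡1)
      where
      w≈x : w ≈w Δ⁻¹ 1 (W 0)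
      w≈x = ≈w-trans w≈ (decode-cong 1 b (≈w-sym (proj₁ tower)))
      tw : DeltaTower b w (cons w W)
      tw = tower-cons (λ n → subst (IsLetter b) (sym (w≈x n)) (Δ⁻¹-letters (W 0) (inj₁ refl) n))
                      (Runs-resp-word (≈w-sym w≈x) (Runs-Δ⁻¹ 1 (OverAlph⇒Positive (letters 0)))) tower

    Lyndon∧Φ11⇒≈Δinv₁-minimal : ∀ {w} → InfLyndon w → PhiStarts11 b w → w ≈w Δinv₁ b m
    Lyndon∧Φ11⇒≈Δinv₁-minimal {w} lyndon (V , tV@(w≈V0 , aV , rV) , V00≡1 , V10≡1) =
      ≈w-trans (≈w-sym w≈V0) (≈w-trans V0≈Δ⁻¹-1-V1 (decode-cong 1 b (≈w-trans V1≈W0 (proj₁ tower))))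
      where
      runs′ : ∀ k → Runs (V k) (V (suc k))
      runs′ k = IsΔ⇒Runs (rV k)
      shapes : ∀ k → alternating EvenMin EvenMax k (V (suc k))
      shapes = alternating-induction (V ∘ suc)
        (λ k → EvenMin-Δ (runs′ (suc k)) (aV (suc k)) (aV (suc (suc k))))
        (λ k → EvenMax-Δ (runs′ (suc k)) (aV (suc k)) (aV (suc (suc k))))
        (Lyndon-Δ (runs′ 0) (aV 0) (aV 1) (InfLyndon-resp-≈ (≈w-sym w≈V0) lyndon) V00≡1 V10≡1)
      heads : ∀ k → V (suc k) 0 ≡ alternating (W 0) (W 1) k 0
      heads k = alternating-relate (λ v v′ → v 0 ≡ v′ 0) {W 0} {W 1}
        (λ min → trans (EvenMin.even-1 min 0 refl) (sym head≡1))
        (λ max → trans (EvenMax.head-b max) (sym Δ-head≡b)) k (shapes k)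
      V1≈W0 : V 1 ≈w W 0
      V1≈W0 = towers-≈-by-heads (tower-tail tV) periodic-tower heads 0
      V0≈Δ⁻¹-1-V1 : V 0 ≈w Δ⁻¹ 1 (V 1)
      V0≈Δ⁻¹-1-V1 = subst (λ a → V 0 ≈w Δ⁻¹ a (V 1)) V00≡1 (≈Δ⁻¹ (runs′ 0) (aV 0))

proposition28 : (b : ℕ) → 1 < b → b % 2 ≡ 1 →
    (m : Word) → IsMinSmooth b m →
    (w : Word) →
    (Smooth b w × InfLyndon w × PhiStarts11 b w) ⇔ (w ≈w Δinv₁ b m)
proposition28 b 1<b b-odd m ((W , tower) , minimal) w =
  mk⇔ (λ (_ , lyndon , φ) → Lyndon∧Φ11⇒≈Δinv₁-minimal tower minimal lyndon φ)
      (Δinv₁-minimal-smooth tower minimal)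
  where open OddAlphabet 1<b (%2≡1⇒parity≡1ℙ b b-odd)
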